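{- There is no real number $c$ such that $Z(L(G))\leq c\,B(G)$ for all finite simple graphs $G$.
   Context: For a finite simple graph $H$: colour each vertex black or white. A black vertex $v$ may force a white neighbour $w$ to become black if $w$ is the only white neighbour of $v$. A set $S\subseteq V(H)$ is a zero-forcing set if, colouring exactly the vertices of $S$ black and repeatedly applying this rule, all vertices eventually become black. The zero-forcing number $Z(H)$ is the minimum size of a zero-forcing set. Brushing: initially every vertex and every edge of $G$ is dirty. An initial configuration places a nonnegative integer number of brushes at each vertex. At each step a single remaining vertex $v$ fires; $v$ may fire only if the number of brushes currently at $v$ is at least the number of dirty edges currently incident with $v$. When $v$ fires, $v$ becomes clean, and each dirty edge incident with $v$ is traversed by at least one brush (distinct brushes for distinct edges; several brushes may traverse the same edge), which cleans that edge and moves those brushes to its other endpoint; excess brushes may remain at $v$ but play no further role; $v$ and its incident edges are then removed. The process ends when no vertex can fire. A configuration cleans $G$ if some such process cleans all vertices and edges. $B(G)$ is the minimum total number of brushes in a configuration that cleans $G$. $L(G)$ denotes the line graph of $G$: its vertices are the edges of $G$, two being adjacent iff they share an endpoint in $G$.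
   Formalization: The constant c is taken in the rationals rather than in the real numbers. -}

module Defs where

open import Data.Nat using (ℕ; zero; suc; _+_; _∸_; _≤_)
open import Data.Fin using (Fin; _≟_)
import Data.Fin as F
open import Data.Bool using (Bool; true; false; if_then_else_; _∧_)
open import Data.List using (List; length; map; allFin)
open import Data.Nat.ListAction using (sum)
open import Data.List.Membership.Propositional using (_∈_)
open import Data.List.Relation.Unary.Unique.Propositional using (Unique)
open import Data.Product using (Σ; _×_; _,_; proj₁; proj₂; ∃)
open import Data.Sum using (_⊎_)
open import Relation.Binary.PropositionalEquality using (_≡_; _≢_)
open import Relation.Nullary using (yes; no)
open import Relation.Binary.Construct.Closure.ReflexiveTransitive using (Star)

record SimpleGraph : Set where
  field
    n     : ℕ
    Adj   : Fin n → Fin n → Bool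
    sym   : ∀ i j → Adj i j ≡ Adj j i
    loopless : ∀ i → Adj i i ≡ false
open SimpleGraph public

record Graph : Set₁ where
  field
    V   : Set
    E   : V → V → Set
open Graph public

-- Line graph: vertices are the edges {i,j} of G, represented as i < j
-- with Adj i j ≡ true; two are adjacent iff distinct and sharing an endpoint.

EdgeOf : SimpleGraph → Set
EdgeOf G = Σ (Fin (n G) × Fin (n G))
             (λ p → (proj₁ p F.< proj₂ p) × (Adj G (proj₁ p) (proj₂ p) ≡ true))

ShareEnd : {k : ℕ} → Fin k × Fin k → Fin k × Fin k → Set
ShareEnd (a , b) (c , d) = (a ≡ c) ⊎ (a ≡ d) ⊎ (b ≡ c) ⊎ (b ≡ d)

lineGraph : SimpleGraph → Graph
lineGraph G = record
  { V = EdgeOf G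
  ; E = λ e f → (proj₁ e ≢ proj₁ f) × ShareEnd (proj₁ e) (proj₁ f)
  }

-- Zero forcing. Black H S v : v is black after repeatedly applying the
-- colour-change rule starting from exactly S black (least closed set).

data Black (H : Graph) (S : List (V H)) : V H → Set where
  init  : ∀ {v} → v ∈ S → Black H S v
  force : ∀ {u w} → Black H S u → E H u w
        → (∀ x → E H u x → x ≢ w → Black H S x)
        → Black H S w

IsZeroForcingSet : (H : Graph) → List (V H) → Set
IsZeroForcingSet H S = ∀ v → Black H S v

-- Z(H) ≡ m : m is the minimum size of a zero-forcing set
-- (sets represented as duplicate-free lists).
IsZ : Graph → ℕ → Set
IsZ H m =
  (Σ (List (V H)) λ S → Unique S × IsZeroForcingSet H S × length S ≡ m)
  × (∀ S → Unique S → IsZeroForcingSet H S → m ≤ length S)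

module Brushing (G : SimpleGraph) where
  N = n G

  ΣF : (Fin N → ℕ) → ℕ
  ΣF f = sum (map f (allFin N))

  -- State: which vertices remain (true = not yet fired), brushes per vertex.
  State : Set
  State = (Fin N → Bool) × (Fin N → ℕ)

  -- u is joined to v by a dirty edge: u remains and is adjacent to v
  -- (an edge is dirty iff neither endpoint has fired yet).
  dirtyTo : (Fin N → Bool) → Fin N → Fin N → Bool
  dirtyTo R v u = R u ∧ Adj G v u

  dirtyDeg : (Fin N → Bool) → Fin N → ℕ
  dirtyDeg R v = ΣF (λ u → if dirtyTo R v u then 1 else 0)

  remove : (Fin N → Bool) → Fin N → Fin N → Bool
  remove R v u with u ≟ v
  ... | yes _ = false
  ... | no  _ = R u

  move : (Fin N → ℕ) → Fin N → (Fin N → ℕ) → Fin N → ℕ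
  move b v f u with u ≟ v
  ... | yes _ = b v ∸ ΣF f
  ... | no  _ = b u + f u

  data Fire : State → State → Set where
    fire : ∀ {R b} (v : Fin N) (f : Fin N → ℕ)
         → R v ≡ true
         → dirtyDeg R v ≤ b v
         → (∀ u → dirtyTo R v u ≡ true → 1 ≤ f u)
         → (∀ u → dirtyTo R v u ≡ false → f u ≡ 0)
         → ΣF f ≤ b v
         → Fire (R , b) (remove R v , move b v f)

  allTrue : Fin N → Bool
  allTrue _ = true

  -- configuration b cleans G: some firing sequence fires every vertex
  -- (then every edge has been cleaned as well).
  Cleans : (Fin N → ℕ) → Set
  Cleans b = Σ State λ s → Star Fire (allTrue , b) s × (∀ u → proj₁ s u ≡ false)

IsB : SimpleGraph → ℕ → Set
IsB G m =
  (Σ (Fin (n G) → ℕ) λ b → Cleans b × ΣF b ≡ m)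
  × (∀ b → Cleans b → m ≤ ΣF b)
  where open Brushing G

module Submission where

-- The witnesses are the squares P²_N of paths (vertices 0, …, N-1, with
-- i ~ j iff |i - j| ∈ {1, 2}).
--  * B(P²_N) ≤ 3.  Firing the vertices in the order 0, 1, 2, … works
--    whenever every vertex holds at least as many brushes (its own plus
--    one from each earlier neighbour) as it has later neighbours; this
--    sequential brushing lemma is proved for arbitrary graphs.  In P²_N
--    every vertex has at most two later neighbours, and with two brushes
--    at 0 and one at 1 every vertex holds at least two.
--  * Z(L(P²_{2k+1})) ≥ k.  The three edges of a triangle form a fort of
--    the line graph (no outside edge is adjacent to exactly one of them);
--    a zero-forcing set meets every nonempty fort, so k edge-disjoint
--    triangles {2m, 2m+1, 2m+2} force k vertices into every such set.
--  * Z and B are minima, which exist up to double negation; that is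
--    enough to refute the bound: z ≤ c·b with b ≤ 3 gives k ≤ 3·|num c|,
--    false for k = 3·|num c| + 1.
-- The graph theory works with the order on ℕ and is kept in the module
-- Combinatorics, so that its notation does not clash with the rational
-- ≤ and * of the statement; the rational arithmetic and the theorem
-- come last.

open import Defs hiding (sym)
open import Data.Nat using (ℕ)
open import Data.Product using (Σ)
open import Relation.Nullary using (¬_)

module Combinatorics where
  open import Data.Nat as ℕ using (zero; suc; _+_; _≤_; _<_; z≤n; s≤s; _≡ᵇ_; _≤?_; _<?_; ⌊_/2⌋)
  import Data.Nat.Properties as ℕP
  open import Data.Nat.Induction using (<-rec)
  open import Data.Fin as F using (Fin; toℕ; fromℕ<)
  import Data.Fin.Properties as FP
  open import Data.Bool using (Bool; true; false; if_then_else_; _∧_; _∨_)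
  import Data.Bool.Properties as BoolP
  open import Data.Maybe using (Maybe; just; nothing)
  import Data.Maybe.Relation.Unary.Any as MaybeAny
  open import Data.List using (List; tabulate; map; allFin; length; lookup; mapMaybe; cartesianProduct; deduplicate)
  open import Data.Nat.ListAction using (sum)
  import Data.List.Properties as LP
  open import Data.List.Membership.Propositional using (_∈_; lose)
  open import Data.List.Membership.Propositional.Properties using (∈-allFin; ∈-cartesianProduct⁺; ∈-deduplicate⁺)
  open import Data.List.Relation.Unary.Any as Any using (Any; any?)
  import Data.List.Relation.Unary.Any.Properties as AnyP
  open import Data.List.Relation.Unary.Unique.Propositional using (Unique)
  open import Data.List.Relation.Unary.Unique.DecPropositional.Properties using (deduplicate-!)
  open import Data.Product using (∃; _×_; _,_; proj₁; proj₂)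
  open import Data.Product.Properties using (≡-dec)
  open import Data.Sum using (_⊎_; inj₁; inj₂)
  open import Data.Empty using (⊥-elim)
  open import Function using (_∘_)
  open import Function.Bundles using (mk⇔)
  open import Algebra.Properties.CommutativeSemigroup ℕP.+-commutativeSemigroup using (interchange)
  open import Axiom.UniquenessOfIdentityProofs using (module Decidable⇒UIP)
  open import Relation.Binary.PropositionalEquality
  open import Relation.Binary.Definitions using (DecidableEquality)
  open import Relation.Binary.Construct.Closure.ReflexiveTransitive using (Star; ε; _◅_)
  open import Relation.Nullary using (does; yes; no)
  open import Relation.Nullary.Decidable using (dec-true; dec-false; does-⇔; map′; _⊎-dec_)
  open import Relation.Unary using (Decidable)

  ∑ : ∀ {N} → (Fin N → ℕ) → ℕ
  ∑ f = sum (tabulate f)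

  ΣF≡∑ : ∀ {N} (f : Fin N → ℕ) → sum (map f (allFin N)) ≡ ∑ f
  ΣF≡∑ f = cong sum (LP.map-tabulate (λ i → i) f)

  ∑-cong : ∀ {N} {f g : Fin N → ℕ} → (∀ i → f i ≡ g i) → ∑ f ≡ ∑ g
  ∑-cong f≗g = cong sum (LP.tabulate-cong f≗g)

  ∑-mono : ∀ {N} {f g : Fin N → ℕ} → (∀ i → f i ≤ g i) → ∑ f ≤ ∑ g
  ∑-mono {zero}  f≤g = z≤n
  ∑-mono {suc N} f≤g = ℕP.+-mono-≤ (f≤g F.zero) (∑-mono (f≤g ∘ F.suc))

  ∑-zero : ∀ {N} → ∑ {N} (λ _ → 0) ≡ 0
  ∑-zero {zero}  = refl
  ∑-zero {suc N} = ∑-zero {N}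

  ∑-+ : ∀ {N} (f g : Fin N → ℕ) → ∑ (λ i → f i + g i) ≡ ∑ f + ∑ g
  ∑-+ {zero}  f g = refl
  ∑-+ {suc N} f g =
    trans (cong (f F.zero + g F.zero +_) (∑-+ (f ∘ F.suc) (g ∘ F.suc)))
          (interchange (f F.zero) (g F.zero) (∑ (f ∘ F.suc)) (∑ (g ∘ F.suc)))

  ∑-point : ∀ {N} (v : Fin N) c → ∑ (λ w → if does (w F.≟ v) then c else 0) ≡ c
  ∑-point {suc N} F.zero    c = trans (cong (c +_) (∑-zero {N})) (ℕP.+-identityʳ c)
  ∑-point {suc N} (F.suc v) c = ∑-point v c

  𝟙 : Bool → ℕ
  𝟙 b = if b then 1 else 0

  <-suc-skip : ∀ {m n} → m ≢ n → does (m <? suc n) ≡ does (m <? n)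
  <-suc-skip {m} {n} m≢n =
    does-⇔ (mk⇔ (λ m<1+n → ℕP.≤∧≢⇒< (ℕP.≤-pred m<1+n) m≢n) ℕP.m<n⇒m<1+n) (m <? suc n) (m <? n)

  ≤-skip : ∀ {i u} → u ≢ i → does (i ≤? u) ≡ does (suc i ≤? u)
  ≤-skip {i} {u} u≢i =
    does-⇔ (mk⇔ (λ i≤u → ℕP.≤∧≢⇒< i≤u (u≢i ∘ sym)) ℕP.<⇒≤) (i ≤? u) (suc i ≤? u)

  -- When vertex v fires it holds its initial brushes plus one
  -- brush from each earlier neighbour, and must send one brush to each
  -- later neighbour.

  module Sequential (G : SimpleGraph) where
    open Brushing G

    remaining : ℕ → Fin N → Bool
    remaining i u = does (i ≤? toℕ u)

    earlier : ℕ → Fin N → ℕ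
    earlier i u = ∑ (λ w → 𝟙 (does (toℕ w <? i) ∧ Adj G w u))

    later : Fin N → ℕ
    later v = dirtyDeg (remaining (toℕ v)) v

    earlier-suc : ∀ v u → earlier (suc (toℕ v)) u ≡ earlier (toℕ v) u + 𝟙 (Adj G v u)
    earlier-suc v u = begin
      earlier (suc (toℕ v)) u                                   ≡⟨ ∑-cong split ⟩
      ∑ (λ w → 𝟙 (does (toℕ w <? toℕ v) ∧ Adj G w u) + point w)  ≡⟨ ∑-+ _ point ⟩
      earlier (toℕ v) u + ∑ point
        ≡⟨ cong (earlier (toℕ v) u +_) (∑-point v _) ⟩
      earlier (toℕ v) u + 𝟙 (Adj G v u)                          ∎
      where
      open ≡-Reasoning
      point : Fin N → ℕ
      point w = if does (w F.≟ v) then 𝟙 (Adj G v u) else 0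
      split : ∀ w → 𝟙 (does (toℕ w <? suc (toℕ v)) ∧ Adj G w u)
                  ≡ 𝟙 (does (toℕ w <? toℕ v) ∧ Adj G w u) + point w
      split w with w F.≟ v
      ... | yes refl rewrite dec-true (toℕ v <? suc (toℕ v)) ℕP.≤-refl
                           | dec-false (toℕ v <? toℕ v) (ℕP.n≮n (toℕ v)) = refl
      ... | no w≢v rewrite <-suc-skip (w≢v ∘ FP.toℕ-injective) =
            sym (ℕP.+-identityʳ _)

    After : (Fin N → ℕ) → ℕ → State → Set
    After b₀ i (R , b) = (∀ u → R u ≡ remaining i u)
                       × (∀ u → i ≤ toℕ u → b u ≡ b₀ u + earlier i u)

    CanPay : (Fin N → ℕ) → Set
    CanPay b₀ = ∀ v → later v ≤ b₀ v + earlier (toℕ v) v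

    fire-next : ∀ {b₀} → CanPay b₀ → ∀ v s → After b₀ (toℕ v) s →
                Σ State λ s′ → Fire s s′ × After b₀ (suc (toℕ v)) s′
    fire-next {b₀} pay v (R , b) (R≗ , b≗) =
      (remove R v , move b v sent) , fire v sent v-present enough sent-pos sent-zero enough ,
      remove≗ , move≗
      where
      sent : Fin N → ℕ
      sent u = 𝟙 (dirtyTo R v u)
      v-present : R v ≡ true
      v-present = trans (R≗ v) (dec-true (toℕ v ≤? toℕ v) ℕP.≤-refl)
      enough : dirtyDeg R v ≤ b v
      enough = begin
        dirtyDeg R v
          ≡⟨ cong sum (LP.map-cong (λ u → cong (λ r → 𝟙 (r ∧ Adj G v u)) (R≗ u)) (allFin N)) ⟩
        later v                     ≤⟨ pay v ⟩
        b₀ v + earlier (toℕ v) v    ≡⟨ sym (b≗ v ℕP.≤-refl) ⟩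
        b v                         ∎
        where open ℕP.≤-Reasoning
      sent-pos : ∀ u → dirtyTo R v u ≡ true → 1 ≤ sent u
      sent-pos u dirty rewrite dirty = ℕP.≤-refl
      sent-zero : ∀ u → dirtyTo R v u ≡ false → sent u ≡ 0
      sent-zero u clean rewrite clean = refl
      remove≗ : ∀ u → remove R v u ≡ remaining (suc (toℕ v)) u
      remove≗ u with u F.≟ v
      ... | yes refl = sym (dec-false (suc (toℕ v) ≤? toℕ v) ℕP.1+n≰n)
      ... | no u≢v = trans (R≗ u) (≤-skip (u≢v ∘ FP.toℕ-injective))
      move≗ : ∀ u → suc (toℕ v) ≤ toℕ u → move b v sent u ≡ b₀ u + earlier (suc (toℕ v)) u
      move≗ u v<u with u F.≟ v
      ... | yes refl = ⊥-elim (ℕP.n≮n (toℕ v) v<u)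
      ... | no _ rewrite b≗ u (ℕP.<⇒≤ v<u) | R≗ u | dec-true (toℕ v ≤? toℕ u) (ℕP.<⇒≤ v<u)
                       | earlier-suc v u = ℕP.+-assoc (b₀ u) _ _

    fire-rest : ∀ {b₀} → CanPay b₀ → ∀ j i s → i + j ≡ N → After b₀ i s →
                Σ State λ s′ → Star Fire s s′ × (∀ u → proj₁ s′ u ≡ false)
    fire-rest pay zero i s i+0≡N (R≗ , _) =
      s , ε , λ u → trans (R≗ u) (dec-false (i ≤? toℕ u) (ℕP.<⇒≱ (subst (toℕ u <_) N≡i (FP.toℕ<n u))))
      where N≡i = trans (sym i+0≡N) (ℕP.+-identityʳ i)
    fire-rest {b₀} pay (suc j) i s i+j+1≡N after =
      let (s₁ , first , after₁) = fire-next pay v s (subst (λ k → After b₀ k s) (sym v≡i) after)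
          (s₂ , rest , done)    = fire-rest pay j (suc i) s₁ (trans (sym (ℕP.+-suc i j)) i+j+1≡N)
                                    (subst (λ k → After b₀ (suc k) s₁) v≡i after₁)
      in s₂ , first ◅ rest , done
      where
      i<N : i < N
      i<N = subst (i <_) i+j+1≡N (ℕP.m<m+n i ℕ.z<s)
      v : Fin N
      v = fromℕ< i<N
      v≡i : toℕ v ≡ i
      v≡i = FP.toℕ-fromℕ< i<N

    sequential-cleans : ∀ b₀ → CanPay b₀ → Cleans b₀
    sequential-cleans b₀ pay =
      fire-rest pay N 0 (allTrue , b₀) refl ((λ _ → refl) , λ u _ → sym nothing-earlier)
      where
      nothing-earlier : ∀ {u} → b₀ u + earlier 0 u ≡ b₀ u
      nothing-earlier {u} = trans (cong (b₀ u +_) (∑-zero {N})) (ℕP.+-identityʳ (b₀ u))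

  near : ℕ → ℕ → Bool
  near x y = (suc x ≡ᵇ y) ∨ (suc (suc x) ≡ᵇ y)

  squareAdj : ℕ → ℕ → Bool
  squareAdj x y = near x y ∨ near y x

  near-irrefl : ∀ x → near x x ≡ false
  near-irrefl zero    = refl
  near-irrefl (suc x) = near-irrefl x

  PathSquare : ℕ → SimpleGraph
  PathSquare N = record
    { n        = N
    ; Adj      = λ a b → squareAdj (toℕ a) (toℕ b)
    ; sym      = λ a b → BoolP.∨-comm (near (toℕ a) (toℕ b)) (near (toℕ b) (toℕ a))
    ; loopless = λ a → cong (λ t → t ∨ t) (near-irrefl (toℕ a))
    }

  ∑-label≤1 : ∀ {N} c → ∑ {N} (λ w → 𝟙 (c ≡ᵇ toℕ w)) ≤ 1
  ∑-label≤1 {zero}  c       = z≤n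
  ∑-label≤1 {suc N} zero    = s≤s (ℕP.≤-reflexive (∑-zero {N}))
  ∑-label≤1 {suc N} (suc c) = ∑-label≤1 {N} c

  ∑-label≥1 : ∀ {N} c → c < N → 1 ≤ ∑ {N} (λ w → 𝟙 (c ≡ᵇ toℕ w))
  ∑-label≥1 {suc N} zero    _         = s≤s z≤n
  ∑-label≥1 {suc N} (suc c) (s≤s c<N) = ∑-label≥1 {N} c c<N

  later-point : ∀ x y → 𝟙 (does (x ≤? y) ∧ squareAdj x y) ≤ 𝟙 (suc x ≡ᵇ y) + 𝟙 (suc (suc x) ≡ᵇ y)
  later-point zero    zero                = z≤n
  later-point zero    (suc zero)          = s≤s z≤n
  later-point zero    (suc (suc zero))    = s≤s z≤n
  later-point zero    (suc (suc (suc y))) = z≤n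
  later-point (suc x) zero                = z≤n
  later-point (suc zero)    (suc y)       = later-point zero y
  later-point (suc (suc x)) (suc y)       = later-point (suc x) y

  earlier-point : ∀ x w → 𝟙 (x ≡ᵇ w) + 𝟙 (suc x ≡ᵇ w)
                         ≤ 𝟙 (does (w <? suc (suc x)) ∧ squareAdj w (suc (suc x)))
  earlier-point zero    zero             = s≤s z≤n
  earlier-point zero    (suc zero)       = s≤s z≤n
  earlier-point zero    (suc (suc w))    = z≤n
  earlier-point (suc x) zero             = z≤n
  earlier-point (suc x) (suc w)          = earlier-point x w

  initial : ℕ → ℕ
  initial 0 = 2
  initial 1 = 1
  initial _ = 0

  ∑-initial : ∀ N → ∑ {N} (initial ∘ toℕ) ≤ 3
  ∑-initial zero    = z≤n
  ∑-initial (suc N) = s≤s (s≤s (rest N))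
    where
    rest : ∀ N → ∑ {N} (λ w → initial (suc (toℕ w))) ≤ 1
    rest zero    = z≤n
    rest (suc N) = s≤s (ℕP.≤-reflexive (∑-zero {N}))

  module _ (M : ℕ) where
    open Brushing (PathSquare M) using (Cleans)
    open Sequential (PathSquare M)

    #label : ℕ → ℕ
    #label c = ∑ {M} (λ w → 𝟙 (c ≡ᵇ toℕ w))

    later≤2 : ∀ v → later v ≤ 2
    later≤2 v = begin
      later v
        ≡⟨ ΣF≡∑ {M} _ ⟩
      ∑ {M} (λ u → 𝟙 (does (x ≤? toℕ u) ∧ squareAdj x (toℕ u)))
        ≤⟨ ∑-mono {M} (λ u → later-point x (toℕ u)) ⟩
      ∑ {M} (λ u → 𝟙 (suc x ≡ᵇ toℕ u) + 𝟙 (suc (suc x) ≡ᵇ toℕ u))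
        ≡⟨ ∑-+ {M} (λ u → 𝟙 (suc x ≡ᵇ toℕ u)) _ ⟩
      #label (suc x) + #label (suc (suc x))
        ≤⟨ ℕP.+-mono-≤ (∑-label≤1 {M} (suc x)) (∑-label≤1 {M} (suc (suc x))) ⟩
      2 ∎
      where open ℕP.≤-Reasoning
            x = toℕ v

    earlierAt : ℕ → ℕ
    earlierAt x = ∑ {M} (λ w → 𝟙 (does (toℕ w <? x) ∧ squareAdj (toℕ w) x))

    -- Vertices 0 and 1 start with enough brushes; every later vertex
    -- receives one from each of its two predecessors.
    initial-enough : ∀ x → x < M → 2 ≤ initial x + earlierAt x
    initial-enough zero          _   = ℕP.m≤m+n 2 _
    initial-enough (suc zero)    1<M =
      s≤s (ℕP.≤-trans (∑-label≥1 {M} 0 (ℕP.<-trans ℕ.z<s 1<M)) (∑-mono {M} from-0))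
      where
      from-0 : ∀ w → 𝟙 (0 ≡ᵇ toℕ w) ≤ 𝟙 (does (toℕ w <? 1) ∧ squareAdj (toℕ w) 1)
      from-0 w with toℕ w
      ... | zero  = s≤s z≤n
      ... | suc _ = z≤n
    initial-enough (suc (suc x)) x+2<M = begin
      2
        ≤⟨ ℕP.+-mono-≤ (∑-label≥1 {M} x x<M) (∑-label≥1 {M} (suc x) x+1<M) ⟩
      #label x + #label (suc x)
        ≡⟨ sym (∑-+ {M} (λ w → 𝟙 (x ≡ᵇ toℕ w)) _) ⟩
      ∑ {M} (λ w → 𝟙 (x ≡ᵇ toℕ w) + 𝟙 (suc x ≡ᵇ toℕ w))
        ≤⟨ ∑-mono {M} (λ w → earlier-point x (toℕ w)) ⟩
      earlierAt (suc (suc x)) ∎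
      where open ℕP.≤-Reasoning
            x+1<M = ℕP.<⇒≤ x+2<M
            x<M   = ℕP.<⇒≤ x+1<M

    initial-pays : CanPay (initial ∘ toℕ)
    initial-pays v = ℕP.≤-trans (later≤2 v) (initial-enough (toℕ v) (FP.toℕ<n v))

    path-square-cleans : Cleans (initial ∘ toℕ)
    path-square-cleans = sequential-cleans (initial ∘ toℕ) initial-pays

  path-square-B≤3 : ∀ {M b} → IsB (PathSquare M) b → b ≤ 3
  path-square-B≤3 {M} {b} (_ , least) = begin
    b                       ≤⟨ least (initial ∘ toℕ) (path-square-cleans M) ⟩
    Brushing.ΣF (PathSquare M) (initial ∘ toℕ) ≡⟨ ΣF≡∑ {M} (initial ∘ toℕ) ⟩
    ∑ {M} (initial ∘ toℕ)     ≤⟨ ∑-initial M ⟩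
    3                       ∎
    where open ℕP.≤-Reasoning

  -- Then no vertex of F can ever be forced,
  -- so every zero-forcing set meets every nonempty fort.

  IsFort : (H : Graph) → (V H → Set) → Set
  IsFort H F = ∀ {u w} → ¬ F u → E H u w → F w → ∃ λ x → F x × E H u x × x ≢ w

  module _ {H : Graph} {F : V H → Set} (fort : IsFort H F) where

    fort-stays-white : ∀ {S} → (∀ {s} → s ∈ S → ¬ F s) → ∀ {v} → Black H S v → ¬ F v
    fort-stays-white S∩F=∅ (init v∈S) = S∩F=∅ v∈S
    fort-stays-white S∩F=∅ (force u-black u~w others) Fw =
      let (x , Fx , u~x , x≢w) = fort (fort-stays-white S∩F=∅ u-black) u~w Fw
      in fort-stays-white S∩F=∅ (others x u~x x≢w) Fx

    zero-forcing-meets-fort : Decidable F → ∀ {v} → F v → ∀ S → IsZeroForcingSet H S → Any F S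
    zero-forcing-meets-fort F? Fv S zfs with any? F? S
    ... | yes S∩F = S∩F
    ... | no S∩F=∅ = ⊥-elim (fort-stays-white (λ s∈S Fs → S∩F=∅ (lose s∈S Fs)) (zfs _) Fv)

  -- k pairwise disjoint nonempty forts force every zero-forcing set to
  -- have at least k vertices: each fort contains a member of the set, and
  -- these members are distinct.
  disjoint-forts-bound : ∀ {H : Graph} {k} (F : Fin k → V H → Set) →
    (∀ m → Decidable (F m)) → (∀ m → IsFort H (F m)) → (∀ m → ∃ (F m)) →
    (∀ {m m′} x → F m x → F m′ x → m ≡ m′) →
    ∀ S → IsZeroForcingSet H S → k ≤ length S
  disjoint-forts-bound F F? forts nonempty disjoint S zfs = FP.injective⇒≤ same-member⇒same-fort
    where
    member : ∀ m → Any (F m) S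
    member m = zero-forcing-meets-fort (forts m) (F? m) (proj₂ (nonempty m)) S zfs
    same-member⇒same-fort : ∀ {m m′} → Any.index (member m) ≡ Any.index (member m′) → m ≡ m′
    same-member⇒same-fort {m} {m′} same =
      disjoint _ (AnyP.lookup-index (member m))
               (subst (F m′ ∘ lookup S) (sym same) (AnyP.lookup-index (member m′)))

  -- Triangles give forts of the line graph: an edge outside a triangle
  -- that meets one side of it at a corner q also meets the other side
  -- through q.

  Pair : ℕ → Set
  Pair k = Fin k × Fin k

  Ends : ∀ {k} → Pair k → Fin k → Set
  Ends (x , y) q = x ≡ q ⊎ y ≡ q

  common-end : ∀ {k} (p r : Pair k) → ShareEnd p r → ∃ λ q → Ends p q × Ends r q
  common-end (x , y) (z , w) (inj₁ x≡z)               = z , inj₁ x≡z , inj₁ refl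
  common-end (x , y) (z , w) (inj₂ (inj₁ x≡w))        = w , inj₁ x≡w , inj₂ refl
  common-end (x , y) (z , w) (inj₂ (inj₂ (inj₁ y≡z))) = z , inj₂ y≡z , inj₁ refl
  common-end (x , y) (z , w) (inj₂ (inj₂ (inj₂ y≡w))) = w , inj₂ y≡w , inj₂ refl

  ends⇒share : ∀ {k} (p r : Pair k) {q} → Ends p q → Ends r q → ShareEnd p r
  ends⇒share (x , y) (z , w) (inj₁ x≡q) (inj₁ z≡q) = inj₁ (trans x≡q (sym z≡q))
  ends⇒share (x , y) (z , w) (inj₁ x≡q) (inj₂ w≡q) = inj₂ (inj₁ (trans x≡q (sym w≡q)))
  ends⇒share (x , y) (z , w) (inj₂ y≡q) (inj₁ z≡q) = inj₂ (inj₂ (inj₁ (trans y≡q (sym z≡q))))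
  ends⇒share (x , y) (z , w) (inj₂ y≡q) (inj₂ w≡q) = inj₂ (inj₂ (inj₂ (trans y≡q (sym w≡q))))

  record Triangle (G : SimpleGraph) : Set where
    field
      a b c : Fin (n G)
      a<b   : a F.< b
      b<c   : b F.< c
      ab    : Adj G a b ≡ true
      bc    : Adj G b c ≡ true
      ac    : Adj G a c ≡ true

  module _ {G : SimpleGraph} (T : Triangle G) where
    open Triangle T

    Side : Pair (n G) → Set
    Side p = p ≡ (a , b) ⊎ p ≡ (b , c) ⊎ p ≡ (a , c)

    OnTriangle : EdgeOf G → Set
    OnTriangle e = Side (proj₁ e)

    side-ab side-bc side-ac : EdgeOf G
    side-ab = (a , b) , a<b , ab
    side-bc = (b , c) , b<c , bc
    side-ac = (a , c) , FP.<-trans a<b b<c , ac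

    on-triangle? : Decidable OnTriangle
    on-triangle? e = ≟-pair (proj₁ e) _ ⊎-dec ≟-pair (proj₁ e) _ ⊎-dec ≟-pair (proj₁ e) _
      where ≟-pair = ≡-dec FP._≟_ FP._≟_

    a≢b : a ≢ b
    a≢b = FP.<⇒≢ a<b
    b≢c : b ≢ c
    b≢c = FP.<⇒≢ b<c

    side-start : ∀ {p} → Side p → proj₁ p ≡ a ⊎ proj₁ p ≡ b
    side-start (inj₁ refl)        = inj₁ refl
    side-start (inj₂ (inj₁ refl)) = inj₂ refl
    side-start (inj₂ (inj₂ refl)) = inj₁ refl

    other-side : ∀ {p q} → Side p → Ends p q →
                 Σ (EdgeOf G) λ x → OnTriangle x × proj₁ x ≢ p × Ends (proj₁ x) q
    other-side (inj₁ refl)        (inj₁ refl) = side-ac , inj₂ (inj₂ refl) , b≢c ∘ sym ∘ cong proj₂ , inj₁ refl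
    other-side (inj₁ refl)        (inj₂ refl) = side-bc , inj₂ (inj₁ refl) , a≢b ∘ sym ∘ cong proj₁ , inj₁ refl
    other-side (inj₂ (inj₁ refl)) (inj₁ refl) = side-ab , inj₁ refl , a≢b ∘ cong proj₁ , inj₂ refl
    other-side (inj₂ (inj₁ refl)) (inj₂ refl) = side-ac , inj₂ (inj₂ refl) , a≢b ∘ cong proj₁ , inj₂ refl
    other-side (inj₂ (inj₂ refl)) (inj₁ refl) = side-ab , inj₁ refl , b≢c ∘ cong proj₂ , inj₁ refl
    other-side (inj₂ (inj₂ refl)) (inj₂ refl) = side-bc , inj₂ (inj₁ refl) , a≢b ∘ sym ∘ cong proj₁ , inj₂ refl

    triangle-fort : IsFort (lineGraph G) OnTriangle
    triangle-fort {u} {w} u∉T (_ , share) w∈T =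
      let (q , u∋q , w∋q)       = common-end (proj₁ u) (proj₁ w) share
          (x , x∈T , x≢w , x∋q) = other-side w∈T w∋q
          u≢x : proj₁ u ≢ proj₁ x
          u≢x u≡x               = u∉T (subst Side (sym u≡x) x∈T)
      in x , x∈T , (u≢x , ends⇒share (proj₁ u) (proj₁ x) u∋q x∋q) , x≢w ∘ cong proj₁

  near-1 : ∀ x → near x (suc x) ≡ true
  near-1 zero    = refl
  near-1 (suc x) = near-1 x

  near-2 : ∀ x → near x (suc (suc x)) ≡ true
  near-2 zero    = refl
  near-2 (suc x) = near-2 x

  module _ {M : ℕ} where
    vertex : ∀ x → x < M → Fin M
    vertex x x<M = fromℕ< x<M

    vertex-< : ∀ {x y} (x<M : x < M) (y<M : y < M) → x < y → vertex x x<M F.< vertex y y<M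
    vertex-< x<M y<M x<y rewrite FP.toℕ-fromℕ< x<M | FP.toℕ-fromℕ< y<M = x<y

    vertex-adj : ∀ {x y} (x<M : x < M) (y<M : y < M) → near x y ≡ true →
                 Adj (PathSquare M) (vertex x x<M) (vertex y y<M) ≡ true
    vertex-adj x<M y<M near-xy rewrite FP.toℕ-fromℕ< x<M | FP.toℕ-fromℕ< y<M | near-xy = refl

    pathTriangle : ∀ x → suc (suc x) < M → Triangle (PathSquare M)
    pathTriangle x x+2<M = record
      { a   = vertex x x<M
      ; b   = vertex (suc x) x+1<M
      ; c   = vertex (suc (suc x)) x+2<M
      ; a<b = vertex-< x<M x+1<M (ℕP.n<1+n x)
      ; b<c = vertex-< x+1<M x+2<M (ℕP.n<1+n (suc x))
      ; ab  = vertex-adj x<M x+1<M (near-1 x)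
      ; bc  = vertex-adj x+1<M x+2<M (near-1 (suc x))
      ; ac  = vertex-adj x<M x+2<M (near-2 x)
      }
      where x+1<M = ℕP.<⇒≤ x+2<M
            x<M   = ℕP.<⇒≤ x+1<M

    pathTriangle-start : ∀ x (x+2<M : suc (suc x) < M) {p} → Side (pathTriangle x x+2<M) p →
                         toℕ (proj₁ p) ≡ x ⊎ toℕ (proj₁ p) ≡ suc x
    pathTriangle-start x x+2<M s with side-start (pathTriangle x x+2<M) s
    ... | inj₁ refl = inj₁ (FP.toℕ-fromℕ< (ℕP.<⇒≤ (ℕP.<⇒≤ x+2<M)))
    ... | inj₂ refl = inj₂ (FP.toℕ-fromℕ< (ℕP.<⇒≤ x+2<M))

  module _ (k : ℕ) where
    fits : ∀ (m : Fin k) → suc (suc (toℕ m + toℕ m)) < suc (k + k)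
    fits m = s≤s (subst (_≤ k + k) (cong suc (ℕP.+-suc (toℕ m) (toℕ m)))
                        (ℕP.+-mono-≤ (FP.toℕ<n m) (FP.toℕ<n m)))

    square-triangle : Fin k → Triangle (PathSquare (suc (k + k)))
    square-triangle m = pathTriangle (toℕ m + toℕ m) (fits m)

    side-start-half : ∀ m {x} → OnTriangle (square-triangle m) x → ⌊ toℕ (proj₁ (proj₁ x)) /2⌋ ≡ toℕ m
    side-start-half m x∈T with pathTriangle-start (toℕ m + toℕ m) (fits m) x∈T
    ... | inj₁ start≡2m   = trans (cong ⌊_/2⌋ start≡2m) (sym (ℕP.n≡⌊n+n/2⌋ (toℕ m)))
    ... | inj₂ start≡2m+1 = trans (cong ⌊_/2⌋ start≡2m+1) (sym (ℕP.n≡⌈n+n/2⌉ (toℕ m)))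

    square-triangles-disjoint : ∀ {m m′} x → OnTriangle (square-triangle m) x →
                                OnTriangle (square-triangle m′) x → m ≡ m′
    square-triangles-disjoint {m} {m′} x x∈T x∈T′ =
      FP.toℕ-injective (trans (sym (side-start-half m {x} x∈T)) (side-start-half m′ {x} x∈T′))

    line-square-zero-forcing : ∀ S → IsZeroForcingSet (lineGraph (PathSquare (suc (k + k)))) S → k ≤ length S
    line-square-zero-forcing =
      disjoint-forts-bound {H = lineGraph (PathSquare (suc (k + k)))}
        (OnTriangle ∘ square-triangle) (on-triangle? ∘ square-triangle) (triangle-fort ∘ square-triangle) (λ m → side-ab (square-triangle m) , inj₁ refl)
        square-triangles-disjoint

    line-square-Z≥k : ∀ {z} → IsZ (lineGraph (PathSquare (suc (k + k)))) z → k ≤ z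
    line-square-Z≥k ((S , _ , zfs , |S|≡z) , _) = subst (k ≤_) |S|≡z (line-square-zero-forcing S zfs)

  -- Z and B are attained: a nonempty set of sizes has a least element.
  -- Constructively this holds up to double negation, which suffices for
  -- refuting the bound.

  ¬¬-least : (P : ℕ → Set) → ∀ n → P n → ¬ ¬ ∃ λ m → P m × (∀ i → P i → m ≤ i)
  ¬¬-least P = <-rec (λ n → P n → ¬ ¬ ∃ λ m → P m × (∀ i → P i → m ≤ i))
    λ n smaller Pn no-least → no-least (n , Pn , λ i Pi → ℕP.≮⇒≥ λ i<n → smaller i<n Pi no-least)

  ¬¬-Z : (H : Graph) → ∀ S → Unique S → IsZeroForcingSet H S → ¬ ¬ ∃ (IsZ H)
  ¬¬-Z H S unique zfs no-Z = ¬¬-least Size (length S) (S , unique , zfs , refl)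
    λ (z , size-z , least) →
      no-Z (z , size-z , λ S′ unique′ zfs′ → least (length S′) (S′ , unique′ , zfs′ , refl))
    where
    Size : ℕ → Set
    Size z = Σ (List (V H)) λ S → Unique S × IsZeroForcingSet H S × length S ≡ z

  ¬¬-B : (G : SimpleGraph) → ∀ b → Brushing.Cleans G b → ¬ ¬ ∃ (IsB G)
  ¬¬-B G b cleans no-B = ¬¬-least Size (ΣF b) (b , cleans , refl)
    λ (m , size-m , least) → no-B (m , size-m , λ b′ cleans′ → least (ΣF b′) (b′ , cleans′ , refl))
    where
    open Brushing G
    Size : ℕ → Set
    Size m = Σ (Fin N → ℕ) λ b → Cleans b × ΣF b ≡ m

  module _ (G : SimpleGraph) where
    edge-≡ : ∀ {x y : EdgeOf G} → proj₁ x ≡ proj₁ y → x ≡ y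
    edge-≡ {p , lt , adj} {.p , lt′ , adj′} refl
      rewrite FP.<-irrelevant lt lt′ | Decidable⇒UIP.≡-irrelevant BoolP._≟_ adj adj′ = refl

    _≟-edge_ : DecidableEquality (EdgeOf G)
    x ≟-edge y = map′ edge-≡ (cong proj₁) (≡-dec FP._≟_ FP._≟_ (proj₁ x) (proj₁ y))

    toEdge : Pair (n G) → Maybe (EdgeOf G)
    toEdge (i , j) with i F.<? j | Adj G i j BoolP.≟ true
    ... | yes i<j | yes adj = just ((i , j) , i<j , adj)
    ... | _       | _       = nothing

    toEdge-complete : ∀ x → toEdge (proj₁ x) ≡ just x
    toEdge-complete ((i , j) , i<j , adj) with i F.<? j | Adj G i j BoolP.≟ true
    ... | yes _   | yes _    = cong just (edge-≡ refl)
    ... | no i≮j  | _        = ⊥-elim (i≮j i<j)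
    ... | yes _   | no ¬adj  = ⊥-elim (¬adj adj)

    edges : List (EdgeOf G)
    edges = deduplicate _≟-edge_ (mapMaybe toEdge (cartesianProduct (allFin (n G)) (allFin (n G))))

    edges-unique : Unique edges
    edges-unique = deduplicate-! _≟-edge_ _

    edges-complete : ∀ x → x ∈ edges
    edges-complete x@((i , j) , _) = ∈-deduplicate⁺ _≟-edge_ (AnyP.mapMaybe⁺ toEdge _ (AnyP.map⁺
      (Any.map (λ { refl → subst (MaybeAny.Any (x ≡_)) (sym (toEdge-complete x)) (MaybeAny.just refl) })
               (∈-cartesianProduct⁺ (∈-allFin i) (∈-allFin j)))))

    edges-zero-forcing : IsZeroForcingSet (lineGraph G) edges
    edges-zero-forcing x = init (edges-complete x)

open Combinatorics
  using (PathSquare; initial; path-square-cleans; path-square-B≤3; line-square-Z≥k;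
         edges; edges-unique; edges-zero-forcing; ¬¬-Z; ¬¬-B)

open import Data.Integer using (+_)
open import Data.Rational using (ℚ; _/_; _*_; _≤_)
open import Data.Rational using (mkℚ; ↥_; toℚᵘ)
import Data.Nat as ℕ
import Data.Nat.Properties as ℕP
import Data.Integer as ℤ
import Data.Integer.Properties as ℤP
import Data.Rational.Properties as ℚP
import Data.Rational.Unnormalised as ℚᵘ
import Data.Rational.Unnormalised.Properties as ℚᵘP
import Data.Nat.Coprimality as Coprimality
open import Data.Fin using (toℕ)
open import Data.Product using (_,_)
open import Function using (_∘_)
open import Relation.Binary.PropositionalEquality using (_≡_; refl; sym; trans; subst)

z/1 : ℕ → ℚ
z/1 z = mkℚ (+ z) 0 (Coprimality.sym (Coprimality.1-coprimeTo z))

/1≡z/1 : ∀ z → + z / 1 ≡ z/1 z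
/1≡z/1 z = ℚP.↥p/↧p≡p (z/1 z)

+≤⇒≤∣∣ : ∀ {m j} → + m ℤ.≤ j → m ℕ.≤ ℤ.∣ j ∣
+≤⇒≤∣∣ m≤j = ℤP.drop‿+≤+ (ℤP.≤-trans m≤j (ℤP.≤-reflexive (sym j≡+∣j∣)))
  where j≡+∣j∣ = ℤP.0≤i⇒+∣i∣≡i (ℤP.≤-trans (ℤ.+≤+ ℕ.z≤n) m≤j)

unnormalise : ∀ c z b → + z / 1 ≤ c * (+ b / 1) → toℚᵘ (z/1 z) ℚᵘ.≤ toℚᵘ c ℚᵘ.* toℚᵘ (z/1 b)
unnormalise c z b z≤cb =
  ℚᵘP.≤-respʳ-≃ cb≃ (subst (λ q → toℚᵘ q ℚᵘ.≤ toℚᵘ (c * (+ b / 1))) (/1≡z/1 z) (ℚP.toℚᵘ-mono-≤ z≤cb))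
  where
  cb≃ : toℚᵘ (c * (+ b / 1)) ℚᵘ.≃ toℚᵘ c ℚᵘ.* toℚᵘ (z/1 b)
  cb≃ = ℚᵘP.≃-trans (ℚP.toℚᵘ-homo-* c (+ b / 1)) (ℚᵘP.*-congˡ {toℚᵘ c} (ℚP.toℚᵘ-cong (/1≡z/1 b)))

-- If z ≤ c·b for naturals z, b, then z ≤ |numerator of c|·b: clearing the
-- denominator d of c gives z·d ≤ num·b as integers.
below-multiple : ∀ c z b → + z / 1 ≤ c * (+ b / 1) → z ℕ.≤ ℤ.∣ ↥ c ∣ ℕ.* b
below-multiple c@(mkℚ num d-1 _) z b z≤cb with unnormalise c z b z≤cb
... | ℚᵘ.*≤* z*d≤num*b = begin
  z                              ≤⟨ ℕP.m≤m*n z (ℕ.suc (d-1 ℕ.* 1)) ⟩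
  z ℕ.* ℕ.suc (d-1 ℕ.* 1)        ≤⟨ +≤⇒≤∣∣ (subst (ℤ._≤ _) (sym (ℤP.pos-* z _)) z*d≤num*b) ⟩
  ℤ.∣ num ℤ.* + b ℤ.* + 1 ∣       ≡⟨ trans (ℤP.abs-* (num ℤ.* + b) (+ 1))
                                           (trans (ℕP.*-identityʳ _) (ℤP.abs-* num (+ b))) ⟩
  ℤ.∣ num ∣ ℕ.* b                 ∎
  where open ℕP.≤-Reasoning

theorem2 : ¬ (Σ ℚ λ c → ∀ (G : SimpleGraph) (z b : ℕ) → IsZ (lineGraph G) z → IsB G b
               → (+ z / 1) ≤ c * (+ b / 1))
theorem2 (c , bound) =
  ¬¬-Z (lineGraph G) (edges G) (edges-unique G) (edges-zero-forcing G) λ (z , isZ) →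
  ¬¬-B G (initial ∘ toℕ) (path-square-cleans _) λ (b , isB) →
  ℕP.n≮n k (begin-strict
    k                   ≤⟨ line-square-Z≥k k isZ ⟩
    z                   ≤⟨ below-multiple c z b (bound G z b isZ isB) ⟩
    ℤ.∣ ↥ c ∣ ℕ.* b     ≤⟨ ℕP.*-monoʳ-≤ ℤ.∣ ↥ c ∣ (path-square-B≤3 isB) ⟩
    ℤ.∣ ↥ c ∣ ℕ.* 3     <⟨ ℕP.n<1+n _ ⟩
    k                   ∎)
  where
  open ℕP.≤-Reasoning
  k = ℕ.suc (ℤ.∣ ↥ c ∣ ℕ.* 3)
  G = PathSquare (ℕ.suc (k ℕ.+ k))
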